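{- Let $t$ and $t'$ be terms with $t \approx t'$, and let $\theta$ be any substitution. Then $t\langle\theta\rangle \approx t'\langle\theta\rangle$.
   Context: Terms are simply typed $\lambda$-terms built from constants and variables, identified up to $\alpha\beta\eta$-conversion. The constants are partitioned into a set $\mathcal{C}$ of nominal constants (infinitely many at each relevant type) and a set $\mathcal{K}$ of ordinary constants. For a term $t$, $\mathrm{supp}(t)$ is the set of nominal constants occurring in $t$. A permutation of nominal constants is a type-preserving bijection $\pi:\mathcal{C}\to\mathcal{C}$ with $\{x \mid \pi(x)\neq x\}$ finite; it acts on terms by $\pi.a=\pi(a)$ for $a\in\mathcal{C}$, $\pi.c=c$ for other atomic $c$ (constants and variables), $\pi.(\lambda x.M)=\lambda x.(\pi.M)$, $\pi.(M\,N)=(\pi.M)(\pi.N)$. We write $B\approx B'$ iff there is a permutation $\pi$ such that $B$ $\lambda$-converts to $\pi.B'$. A substitution is a type-preserving map from variables to terms that is the identity on all but finitely many variables; its support $\mathrm{supp}(\theta)$ is the set of nominal constants occurring in its range. For $\theta=\{t_1/x_1,\dots,t_n/x_n\}$, the ordinary application $B[\theta]$ is the term $(\lambda x_1\dots\lambda x_n.B)\,t_1\cdots t_n$ (i.e. capture-avoiding replacement of variables). The nominal-capture-avoiding application is $B\langle\theta\rangle = (\pi.B)[\theta]$ where $\pi$ is any permutation mapping the nominal constants in $\mathrm{supp}(B)$ to nominal constants not in $\mathrm{supp}(\theta)$ (so $B\langle\theta\rangle$ is determined by a choice of such $\pi$; the claim holds for any choices). -}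

module Defs where

open import Data.Nat using (ℕ)
open import Data.List using (List; []; _∷_)
open import Data.List.Membership.Propositional using (_∈_)
open import Data.Product using (Σ; ∃; _×_; _,_)
open import Relation.Binary.PropositionalEquality using (_≡_)
open import Relation.Nullary using (¬_)

infixr 7 _⇒_
data Ty : Set where
  base : ℕ → Ty
  _⇒_  : Ty → Ty → Ty

-- Bound variables are de Bruijn indices (so α-equivalence is
-- syntactic identity).  Free variables, nominal constants and ordinary
-- constants are each named by a natural number together with a type,
-- so there are infinitely many of each at every type.

Ctx : Set
Ctx = List Ty

infix 4 _∋_
data _∋_ : Ctx → Ty → Set where
  Z : ∀ {Γ A} → (A ∷ Γ) ∋ A
  S_ : ∀ {Γ A B} → Γ ∋ A → (B ∷ Γ) ∋ A

data Tm (Γ : Ctx) : Ty → Set where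
  bvar : ∀ {A} → Γ ∋ A → Tm Γ A
  fvar : (x : ℕ) (A : Ty) → Tm Γ A
  nom  : (a : ℕ) (A : Ty) → Tm Γ A
  con  : (c : ℕ) (A : Ty) → Tm Γ A
  lam  : ∀ {A B} → Tm (A ∷ Γ) B → Tm Γ (A ⇒ B)
  app  : ∀ {A B} → Tm Γ (A ⇒ B) → Tm Γ A → Tm Γ B

-- Closed (with respect to bound variables) terms: the terms of the paper.
Term : Ty → Set
Term A = Tm [] A

Ren : Ctx → Ctx → Set
Ren Γ Δ = ∀ {A} → Γ ∋ A → Δ ∋ A

extR : ∀ {Γ Δ B} → Ren Γ Δ → Ren (B ∷ Γ) (B ∷ Δ)
extR ρ Z     = Z
extR ρ (S x) = S (ρ x)

rename : ∀ {Γ Δ A} → Ren Γ Δ → Tm Γ A → Tm Δ A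
rename ρ (bvar x)  = bvar (ρ x)
rename ρ (fvar x A) = fvar x A
rename ρ (nom a A) = nom a A
rename ρ (con c A) = con c A
rename ρ (lam M)   = lam (rename (extR ρ) M)
rename ρ (app M N) = app (rename ρ M) (rename ρ N)

Sub : Ctx → Ctx → Set
Sub Γ Δ = ∀ {A} → Γ ∋ A → Tm Δ A

extS : ∀ {Γ Δ B} → Sub Γ Δ → Sub (B ∷ Γ) (B ∷ Δ)
extS σ Z     = bvar Z
extS σ (S x) = rename S_ (σ x)

subst : ∀ {Γ Δ A} → Sub Γ Δ → Tm Γ A → Tm Δ A
subst σ (bvar x)   = σ x
subst σ (fvar x A) = fvar x A
subst σ (nom a A)  = nom a A
subst σ (con c A)  = con c A
subst σ (lam M)    = lam (subst (extS σ) M)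
subst σ (app M N)  = app (subst σ M) (subst σ N)

single : ∀ {Γ B} → Tm Γ B → Sub (B ∷ Γ) Γ
single N Z     = N
single N (S x) = bvar x

_[_]₀ : ∀ {Γ A B} → Tm (B ∷ Γ) A → Tm Γ B → Tm Γ A
M [ N ]₀ = subst (single N) M

infix 4 _~_
data _~_ {Γ : Ctx} : ∀ {A} → Tm Γ A → Tm Γ A → Set where
  β      : ∀ {A B} (M : Tm (A ∷ Γ) B) (N : Tm Γ A) → app (lam M) N ~ M [ N ]₀
  η      : ∀ {A B} (M : Tm Γ (A ⇒ B)) → lam (app (rename S_ M) (bvar Z)) ~ M
  ~refl  : ∀ {A} {M : Tm Γ A} → M ~ M
  ~sym   : ∀ {A} {M N : Tm Γ A} → M ~ N → N ~ M
  ~trans : ∀ {A} {M N P : Tm Γ A} → M ~ N → N ~ P → M ~ P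
  ~lam   : ∀ {A B} {M M' : Tm (A ∷ Γ) B} → M ~ M' → lam M ~ lam M'
  ~app   : ∀ {A B} {M M' : Tm Γ (A ⇒ B)} {N N' : Tm Γ A} →
           M ~ M' → N ~ N' → app M N ~ app M' N'

-- Syntactic occurrence of the nominal constant (a , A) in a
-- representative, and the support of a term (an αβη-class): the nominal
-- constants occurring in every representative of the class.

data Occurs {Γ : Ctx} (a : ℕ) (A : Ty) : ∀ {B} → Tm Γ B → Set where
  here  : Occurs a A (nom a A)
  inlam : ∀ {B C} {M : Tm (B ∷ Γ) C} → Occurs a A M → Occurs a A (lam M)
  inl   : ∀ {B C} {M : Tm Γ (B ⇒ C)} {N : Tm Γ B} → Occurs a A M → Occurs a A (app M N)
  inr   : ∀ {B C} {M : Tm Γ (B ⇒ C)} {N : Tm Γ B} → Occurs a A N → Occurs a A (app M N)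

InSupp : ℕ → Ty → ∀ {B} → Term B → Set
InSupp a A t = ∀ t' → t ~ t' → Occurs a A t'

record Perm : Set where
  field
    to     : Ty → ℕ → ℕ
    from   : Ty → ℕ → ℕ
    from∘to : ∀ A a → from A (to A a) ≡ a
    to∘from : ∀ A a → to A (from A a) ≡ a
    dom    : List (ℕ × Ty)
    finite : ∀ a A → ¬ ((a , A) ∈ dom) → to A a ≡ a
open Perm public

infixr 6 _·_
_·_ : ∀ {Γ A} → Perm → Tm Γ A → Tm Γ A
π · bvar x   = bvar x
π · fvar x A = fvar x A
π · nom a A  = nom (to π A a) A
π · con c A  = con c A
π · lam M    = lam (π · M)
π · app M N  = app (π · M) (π · N)

infix 4 _≈_
_≈_ : ∀ {A} → Term A → Term A → Set
B ≈ B' = Σ Perm λ π → B ~ (π · B')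

record Subst : Set where
  field
    map    : (x : ℕ) (A : Ty) → Term A
    dom    : List (ℕ × Ty)
    finite : ∀ x A → ¬ ((x , A) ∈ dom) → map x A ≡ fvar x A
open Subst public

InSuppS : ℕ → Ty → Subst → Set
InSuppS a A θ = Σ ℕ λ x → Σ Ty λ B → InSupp a A (Subst.map θ x B)

weaken₀ : ∀ {Γ A} → Term A → Tm Γ A
weaken₀ = rename (λ ())

_[_] : ∀ {Γ A} → Tm Γ A → Subst → Tm Γ A
bvar x   [ θ ] = bvar x
fvar x A [ θ ] = weaken₀ (Subst.map θ x A)
nom a A  [ θ ] = nom a A
con c A  [ θ ] = con c A
lam M    [ θ ] = lam (M [ θ ])
app M N  [ θ ] = app (M [ θ ]) (N [ θ ])

-- π is an admissible renaming for computing B⟨θ⟩: it maps every nominal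
-- constant in supp(B) to a nominal constant not in supp(θ).
Avoids : ∀ {A} → Perm → Term A → Subst → Set
Avoids π B θ = ∀ a C → InSupp a C B → ¬ InSuppS (to π C a) C θ

-- B⟨θ⟩ computed with the chosen permutation π (requires Avoids π B θ).
nca : ∀ {A} → Term A → Subst → Perm → Term A
nca B θ π = (π · B) [ θ ]

-- A nominal constant in the support of a term occurs in every representative of its
-- αβη-class, in particular in its βη-normal form (computed here by normalisation by
-- evaluation, with soundness tracking occurrences). Hence π · M is determined up to
-- conversion by the action of π on supp(M), and supp(ρ · t') = ρ(supp(t')).
--
-- Writing t ~ ρ · t', we get π · t ~ (π ∘ ρ) · t', where π ∘ ρ again moves supp(t') away
-- from supp(θ); so it suffices to compare (π · M)[θ] and (π' · M)[θ] for two permutations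
-- that both move supp(M) away from supp(θ). Let κ send supp(M) to names fresh for
-- everything in sight, and let σ exchange each π(a) with the fresh name of a. Then
-- σ ∘ κ agrees with π on supp(M) and σ fixes supp(θ), so
-- (π · M)[θ] ~ ((σ ∘ κ) · M)[σ · θ] = σ · ((κ · M)[θ]). The same holds for π', and the
-- two instances combine into the claim.

module Submission where

open import Defs
open import Data.Nat using (ℕ; suc; _<_; _≤_; s≤s)
import Data.Nat as ℕ
open import Data.Nat.Properties
  using (≤-refl; ≤-trans; n≤1+n; <-asym; <-irrefl; m<n⇒m<1+n; <-≤-trans)
import Data.List as List
open import Data.List using (List; []; _∷_; _++_; deduplicate)
open import Data.List.Membership.Propositional using (_∈_; _∉_; lose)
open import Data.List.Membership.Propositional.Properties
  using (∈-++⁺ˡ; ∈-++⁺ʳ; ∈-++⁻; ∈-map⁺; ∈-map⁻; ∈-concatMap⁺; ∈-deduplicate⁺; ∈-deduplicate⁻)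
open import Data.List.Relation.Unary.Any using (here; there)
import Data.List.Relation.Unary.All as All
open import Data.List.Extrema.Nat using (max; xs≤max)
open import Data.List.Relation.Unary.AllPairs using (_∷_)
open import Data.List.Relation.Unary.Unique.Propositional using (Unique)
open import Data.List.Relation.Unary.Unique.Propositional.Properties using (map⁺)
open import Data.Empty using (⊥-elim)
open import Data.Unit using (⊤; tt)
open import Data.Sum using (_⊎_; inj₁; inj₂)
open import Data.Product using (Σ; _×_; _,_; proj₁; proj₂)
open import Data.Product.Properties using (≡-dec)
open import Function using (_∘_)
open import Relation.Nullary using (Dec; yes; no)
open import Relation.Binary.Definitions using (DecidableEquality)
open import Relation.Binary.PropositionalEquality
  using (_≡_; _≢_; refl; sym; trans; cong; cong₂; module ≡-Reasoning)
  renaming (subst to transport)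
import Relation.Binary.Reasoning.Base.Single as SingleRelReasoning

infix 4 _≐_
_≐_ : ∀ {Γ} {T : Ty → Set} (f g : ∀ {A} → Γ ∋ A → T A) → Set
_≐_ {Γ} f g = ∀ {A} (x : Γ ∋ A) → f x ≡ g x

extR-cong : ∀ {Γ Δ B} {f g : Ren Γ Δ} → f ≐ g → extR {B = B} f ≐ extR g
extR-cong e Z     = refl
extR-cong e (S x) = cong S_ (e x)

rename-cong : ∀ {Γ Δ A} {f g : Ren Γ Δ} → f ≐ g → (M : Tm Γ A) → rename f M ≡ rename g M
rename-cong e (bvar x)   = cong bvar (e x)
rename-cong e (fvar x A) = refl
rename-cong e (nom a A)  = refl
rename-cong e (con c A)  = refl
rename-cong e (lam M)    = cong lam (rename-cong (extR-cong e) M)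
rename-cong e (app M N)  = cong₂ app (rename-cong e M) (rename-cong e N)

rename-rename : ∀ {Γ Δ Θ A} (f : Ren Γ Δ) (g : Ren Δ Θ) (M : Tm Γ A) →
                rename g (rename f M) ≡ rename (λ x → g (f x)) M
rename-rename f g (bvar x)   = refl
rename-rename f g (fvar x A) = refl
rename-rename f g (nom a A)  = refl
rename-rename f g (con c A)  = refl
rename-rename f g (lam M)    = cong lam (trans (rename-rename (extR f) (extR g) M)
                                               (rename-cong (λ { Z → refl ; (S x) → refl }) M))
rename-rename f g (app M N)  = cong₂ app (rename-rename f g M) (rename-rename f g N)

rename-id : ∀ {Γ A} (M : Tm Γ A) → rename (λ x → x) M ≡ M
rename-id (bvar x)   = refl
rename-id (fvar x A) = refl
rename-id (nom a A)  = refl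
rename-id (con c A)  = refl
rename-id (lam M)    = cong lam (trans (rename-cong (λ { Z → refl ; (S x) → refl }) M) (rename-id M))
rename-id (app M N)  = cong₂ app (rename-id M) (rename-id N)

extS-cong : ∀ {Γ Δ B} {σ τ : Sub Γ Δ} → σ ≐ τ → extS {B = B} σ ≐ extS τ
extS-cong e Z     = refl
extS-cong e (S x) = cong (rename S_) (e x)

subst-cong : ∀ {Γ Δ A} {σ τ : Sub Γ Δ} → σ ≐ τ → (M : Tm Γ A) → subst σ M ≡ subst τ M
subst-cong e (bvar x)   = e x
subst-cong e (fvar x A) = refl
subst-cong e (nom a A)  = refl
subst-cong e (con c A)  = refl
subst-cong e (lam M)    = cong lam (subst-cong (extS-cong e) M)
subst-cong e (app M N)  = cong₂ app (subst-cong e M) (subst-cong e N)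

subst-rename : ∀ {Γ Δ Θ A} (f : Ren Γ Δ) (σ : Sub Δ Θ) (M : Tm Γ A) →
               subst σ (rename f M) ≡ subst (λ x → σ (f x)) M
subst-rename f σ (bvar x)   = refl
subst-rename f σ (fvar x A) = refl
subst-rename f σ (nom a A)  = refl
subst-rename f σ (con c A)  = refl
subst-rename f σ (lam M)    = cong lam (trans (subst-rename (extR f) (extS σ) M)
                                              (subst-cong (λ { Z → refl ; (S x) → refl }) M))
subst-rename f σ (app M N)  = cong₂ app (subst-rename f σ M) (subst-rename f σ N)

rename-subst : ∀ {Γ Δ Θ A} (σ : Sub Γ Δ) (f : Ren Δ Θ) (M : Tm Γ A) →
               rename f (subst σ M) ≡ subst (λ x → rename f (σ x)) M
rename-subst σ f (bvar x)   = refl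
rename-subst σ f (fvar x A) = refl
rename-subst σ f (nom a A)  = refl
rename-subst σ f (con c A)  = refl
rename-subst σ f (lam M)    = cong lam (trans (rename-subst (extS σ) (extR f) M) (subst-cong ext M))
  where
  ext : (λ x → rename (extR f) (extS σ x)) ≐ extS (λ x → rename f (σ x))
  ext Z     = refl
  ext (S x) = trans (rename-rename S_ (extR f) (σ x)) (sym (rename-rename f S_ (σ x)))
rename-subst σ f (app M N)  = cong₂ app (rename-subst σ f M) (rename-subst σ f N)

subst-subst : ∀ {Γ Δ Θ A} (σ : Sub Γ Δ) (τ : Sub Δ Θ) (M : Tm Γ A) →
              subst τ (subst σ M) ≡ subst (λ x → subst τ (σ x)) M
subst-subst σ τ (bvar x)   = refl
subst-subst σ τ (fvar x A) = refl
subst-subst σ τ (nom a A)  = refl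
subst-subst σ τ (con c A)  = refl
subst-subst σ τ (lam M)    = cong lam (trans (subst-subst (extS σ) (extS τ) M) (subst-cong ext M))
  where
  ext : (λ x → subst (extS τ) (extS σ x)) ≐ extS (λ x → subst τ (σ x))
  ext Z     = refl
  ext (S x) = trans (subst-rename S_ (extS τ) (σ x)) (sym (rename-subst τ S_ (σ x)))
subst-subst σ τ (app M N)  = cong₂ app (subst-subst σ τ M) (subst-subst σ τ N)

subst-bvar∘ : ∀ {Γ Δ A} (f : Ren Γ Δ) {σ : Sub Γ Δ} → σ ≐ (λ x → bvar (f x)) →
              (M : Tm Γ A) → subst σ M ≡ rename f M
subst-bvar∘ f e (bvar x)   = e x
subst-bvar∘ f e (fvar x A) = refl
subst-bvar∘ f e (nom a A)  = refl
subst-bvar∘ f e (con c A)  = refl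
subst-bvar∘ f e (lam M)    =
  cong lam (subst-bvar∘ (extR f) (λ { Z → refl ; (S x) → cong (rename S_) (e x) }) M)
subst-bvar∘ f e (app M N)  = cong₂ app (subst-bvar∘ f e M) (subst-bvar∘ f e N)

subst-id : ∀ {Γ A} (M : Tm Γ A) → subst bvar M ≡ M
subst-id M = trans (subst-bvar∘ (λ x → x) (λ x → refl) M) (rename-id M)

rename-[]₀ : ∀ {Γ Δ A B} (f : Ren Γ Δ) (M : Tm (B ∷ Γ) A) (N : Tm Γ B) →
             rename f (M [ N ]₀) ≡ rename (extR f) M [ rename f N ]₀
rename-[]₀ f M N = begin
  rename f (M [ N ]₀)                          ≡⟨ rename-subst (single N) f M ⟩
  subst (λ x → rename f (single N x)) M        ≡⟨ subst-cong (λ { Z → refl ; (S x) → refl }) M ⟩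
  subst (λ x → single (rename f N) (extR f x)) M ≡⟨ subst-rename (extR f) (single (rename f N)) M ⟨
  rename (extR f) M [ rename f N ]₀            ∎
  where open ≡-Reasoning

~-rename : ∀ {Γ Δ A} (f : Ren Γ Δ) {M N : Tm Γ A} → M ~ N → rename f M ~ rename f N
~-rename f (β M N) = transport (app (lam (rename (extR f) M)) (rename f N) ~_)
                               (sym (rename-[]₀ f M N)) (β (rename (extR f) M) (rename f N))
~-rename f (η M) = transport (λ X → lam (app X (bvar Z)) ~ rename f M)
                             (trans (rename-rename f S_ M) (sym (rename-rename S_ (extR f) M)))
                             (η (rename f M))
~-rename f ~refl        = ~refl
~-rename f (~sym p)     = ~sym (~-rename f p)
~-rename f (~trans p q) = ~trans (~-rename f p) (~-rename f q)
~-rename f (~lam p)     = ~lam (~-rename (extR f) p)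
~-rename f (~app p q)   = ~app (~-rename f p) (~-rename f q)

module ~-Reasoning {Γ : Ctx} {A : Ty} = SingleRelReasoning (_~_ {Γ} {A}) ~refl ~trans

infix 4 _⊆ᴺ_
_⊆ᴺ_ : ∀ {Γ Δ A B} → Tm Γ A → Tm Δ B → Set
X ⊆ᴺ Y = ∀ {a C} → Occurs a C X → Occurs a C Y

Occurs-rename⁻ : ∀ {Γ Δ A} (f : Ren Γ Δ) (M : Tm Γ A) → rename f M ⊆ᴺ M
Occurs-rename⁻ f (nom a A) here      = here
Occurs-rename⁻ f (lam M)   (inlam o) = inlam (Occurs-rename⁻ (extR f) M o)
Occurs-rename⁻ f (app M N) (inl o)   = inl (Occurs-rename⁻ f M o)
Occurs-rename⁻ f (app M N) (inr o)   = inr (Occurs-rename⁻ f N o)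

Occurs-rename⁺ : ∀ {Γ Δ A} (f : Ren Γ Δ) (M : Tm Γ A) → M ⊆ᴺ rename f M
Occurs-rename⁺ f (nom a A) here      = here
Occurs-rename⁺ f (lam M)   (inlam o) = inlam (Occurs-rename⁺ (extR f) M o)
Occurs-rename⁺ f (app M N) (inl o)   = inl (Occurs-rename⁺ f M o)
Occurs-rename⁺ f (app M N) (inr o)   = inr (Occurs-rename⁺ f N o)

Occurs-subst⁻ : ∀ {Γ Δ A} (σ : Sub Γ Δ) (M : Tm Γ A) {a C} → Occurs a C (subst σ M) →
                Occurs a C M ⊎ Σ Ty (λ B → Σ (Γ ∋ B) λ x → Occurs a C (σ x))
Occurs-subst⁻ σ (bvar x)  o         = inj₂ (_ , x , o)
Occurs-subst⁻ σ (nom a A) here      = inj₁ here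
Occurs-subst⁻ σ (lam M)   (inlam o) with Occurs-subst⁻ (extS σ) M o
... | inj₁ p              = inj₁ (inlam p)
... | inj₂ (B , S x , p)  = inj₂ (B , x , Occurs-rename⁻ S_ (σ x) p)
Occurs-subst⁻ σ (app M N) (inl o) with Occurs-subst⁻ σ M o
... | inj₁ p = inj₁ (inl p)
... | inj₂ q = inj₂ q
Occurs-subst⁻ σ (app M N) (inr o) with Occurs-subst⁻ σ N o
... | inj₁ p = inj₁ (inr p)
... | inj₂ q = inj₂ q

Occurs-[]₀⁻ : ∀ {Γ A B} (M : Tm (B ∷ Γ) A) (N : Tm Γ B) → M [ N ]₀ ⊆ᴺ app (lam M) N
Occurs-[]₀⁻ M N o with Occurs-subst⁻ (single N) M o
... | inj₁ p           = inl (inlam p)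
... | inj₂ (_ , Z , p) = inr p

-- Normalisation by evaluation

mutual
  data Ne (Γ : Ctx) : Ty → Set where
    nvar : ∀ {A} → Γ ∋ A → Ne Γ A
    nfv  : (x : ℕ) (A : Ty) → Ne Γ A
    nnom : (a : ℕ) (A : Ty) → Ne Γ A
    ncon : (c : ℕ) (A : Ty) → Ne Γ A
    napp : ∀ {A B} → Ne Γ (A ⇒ B) → Nf Γ A → Ne Γ B

  data Nf (Γ : Ctx) : Ty → Set where
    nne  : ∀ {n} → Ne Γ (base n) → Nf Γ (base n)
    nlam : ∀ {A B} → Nf (A ∷ Γ) B → Nf Γ (A ⇒ B)

mutual
  embNe : ∀ {Γ A} → Ne Γ A → Tm Γ A
  embNe (nvar x)   = bvar x
  embNe (nfv x A)  = fvar x A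
  embNe (nnom a A) = nom a A
  embNe (ncon c A) = con c A
  embNe (napp n v) = app (embNe n) (embNf v)

  embNf : ∀ {Γ A} → Nf Γ A → Tm Γ A
  embNf (nne n)  = embNe n
  embNf (nlam v) = lam (embNf v)

mutual
  renNe : ∀ {Γ Δ A} → Ren Γ Δ → Ne Γ A → Ne Δ A
  renNe f (nvar x)   = nvar (f x)
  renNe f (nfv x A)  = nfv x A
  renNe f (nnom a A) = nnom a A
  renNe f (ncon c A) = ncon c A
  renNe f (napp n v) = napp (renNe f n) (renNf f v)

  renNf : ∀ {Γ Δ A} → Ren Γ Δ → Nf Γ A → Nf Δ A
  renNf f (nne n)  = nne (renNe f n)
  renNf f (nlam v) = nlam (renNf (extR f) v)

mutual
  embNe-renNe : ∀ {Γ Δ A} (f : Ren Γ Δ) (n : Ne Γ A) → embNe (renNe f n) ≡ rename f (embNe n)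
  embNe-renNe f (nvar x)   = refl
  embNe-renNe f (nfv x A)  = refl
  embNe-renNe f (nnom a A) = refl
  embNe-renNe f (ncon c A) = refl
  embNe-renNe f (napp n v) = cong₂ app (embNe-renNe f n) (embNf-renNf f v)

  embNf-renNf : ∀ {Γ Δ A} (f : Ren Γ Δ) (v : Nf Γ A) → embNf (renNf f v) ≡ rename f (embNf v)
  embNf-renNf f (nne n)  = embNe-renNe f n
  embNf-renNf f (nlam v) = cong lam (embNf-renNf (extR f) v)

mutual
  renNe-cong : ∀ {Γ Δ A} {f g : Ren Γ Δ} → f ≐ g → (n : Ne Γ A) → renNe f n ≡ renNe g n
  renNe-cong e (nvar x)   = cong nvar (e x)
  renNe-cong e (nfv x A)  = refl
  renNe-cong e (nnom a A) = refl
  renNe-cong e (ncon c A) = refl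
  renNe-cong e (napp n v) = cong₂ napp (renNe-cong e n) (renNf-cong e v)

  renNf-cong : ∀ {Γ Δ A} {f g : Ren Γ Δ} → f ≐ g → (v : Nf Γ A) → renNf f v ≡ renNf g v
  renNf-cong e (nne n)  = cong nne (renNe-cong e n)
  renNf-cong e (nlam v) = cong nlam (renNf-cong (extR-cong e) v)

mutual
  renNe-renNe : ∀ {Γ Δ Θ A} (f : Ren Γ Δ) (g : Ren Δ Θ) (n : Ne Γ A) →
                renNe g (renNe f n) ≡ renNe (λ x → g (f x)) n
  renNe-renNe f g (nvar x)   = refl
  renNe-renNe f g (nfv x A)  = refl
  renNe-renNe f g (nnom a A) = refl
  renNe-renNe f g (ncon c A) = refl
  renNe-renNe f g (napp n v) = cong₂ napp (renNe-renNe f g n) (renNf-renNf f g v)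

  renNf-renNf : ∀ {Γ Δ Θ A} (f : Ren Γ Δ) (g : Ren Δ Θ) (v : Nf Γ A) →
                renNf g (renNf f v) ≡ renNf (λ x → g (f x)) v
  renNf-renNf f g (nne n)  = cong nne (renNe-renNe f g n)
  renNf-renNf f g (nlam v) = cong nlam (trans (renNf-renNf (extR f) (extR g) v)
                                              (renNf-cong (λ { Z → refl ; (S x) → refl }) v))

mutual
  renNe-id : ∀ {Γ A} (n : Ne Γ A) → renNe (λ x → x) n ≡ n
  renNe-id (nvar x)   = refl
  renNe-id (nfv x A)  = refl
  renNe-id (nnom a A) = refl
  renNe-id (ncon c A) = refl
  renNe-id (napp n v) = cong₂ napp (renNe-id n) (renNf-id v)

  renNf-id : ∀ {Γ A} (v : Nf Γ A) → renNf (λ x → x) v ≡ v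
  renNf-id (nne n)  = cong nne (renNe-id n)
  renNf-id (nlam v) = cong nlam (trans (renNf-cong (λ { Z → refl ; (S x) → refl }) v) (renNf-id v))

Sem : Ty → Ctx → Set
Sem (base n) Γ = Nf Γ (base n)
Sem (A ⇒ B)  Γ = ∀ {Δ} → Ren Γ Δ → Sem A Δ → Sem B Δ

renSem : ∀ {A Γ Δ} → Ren Γ Δ → Sem A Γ → Sem A Δ
renSem {base n} f v = renNf f v
renSem {A ⇒ B}  f F = λ g a → F (λ x → g (f x)) a

mutual
  reflect : ∀ {A Γ} → Ne Γ A → Sem A Γ
  reflect {base n} m = nne m
  reflect {A ⇒ B}  m = λ g a → reflect (napp (renNe g m) (reify a))

  reify : ∀ {A Γ} → Sem A Γ → Nf Γ A
  reify {base n} v = v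
  reify {A ⇒ B}  F = nlam (reify (F S_ (reflect (nvar Z))))

Env : Ctx → Ctx → Set
Env Γ Δ = ∀ {A} → Γ ∋ A → Sem A Δ

extE : ∀ {Γ Δ A} → Env Γ Δ → Sem A Δ → Env (A ∷ Γ) Δ
extE γ a Z     = a
extE γ a (S x) = γ x

renEnv : ∀ {Γ Δ Θ} → Ren Δ Θ → Env Γ Δ → Env Γ Θ
renEnv f γ x = renSem f (γ x)

eval : ∀ {Γ Δ A} → Tm Γ A → Env Γ Δ → Sem A Δ
eval (bvar x)   γ = γ x
eval (fvar x A) γ = reflect (nfv x A)
eval (nom a A)  γ = reflect (nnom a A)
eval (con c A)  γ = reflect (ncon c A)
eval (lam M)    γ = λ g a → eval M (extE (renEnv g γ) a)
eval (app M N)  γ = eval M γ (λ x → x) (eval N γ)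

idEnv : ∀ {Γ} → Env Γ Γ
idEnv x = reflect (nvar x)

nf : ∀ {Γ A} → Tm Γ A → Nf Γ A
nf M = reify (eval M idEnv)

infix 4 _⇝_
_⇝_ : ∀ {Γ A} → Tm Γ A → Tm Γ A → Set
M ⇝ N = (M ~ N) × (N ⊆ᴺ M)

⇝-refl : ∀ {Γ A} {M : Tm Γ A} → M ⇝ M
⇝-refl = ~refl , λ o → o

⇝-trans : ∀ {Γ A} {M N P : Tm Γ A} → M ⇝ N → N ⇝ P → M ⇝ P
⇝-trans (p , q) (p' , q') = ~trans p p' , λ o → q (q' o)

⇝-rename : ∀ {Γ Δ A} (f : Ren Γ Δ) {M N : Tm Γ A} → M ⇝ N → rename f M ⇝ rename f N
⇝-rename f {M} {N} (p , q) =
  ~-rename f p , λ o → Occurs-rename⁺ f M (q (Occurs-rename⁻ f N o))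

⇝-app : ∀ {Γ A B} {M M' : Tm Γ (A ⇒ B)} {N N' : Tm Γ A} → M ⇝ M' → N ⇝ N' → app M N ⇝ app M' N'
⇝-app (p , q) (p' , q') = ~app p p' , λ { (inl o) → inl (q o) ; (inr o) → inr (q' o) }

Sound : ∀ {Γ} A → Tm Γ A → Sem A Γ → Set
Sound (base n)     M v = M ⇝ embNf v
Sound {Γ} (A ⇒ B) M F = ∀ {Δ} (g : Ren Γ Δ) {N : Tm Δ A} {a : Sem A Δ} →
                         Sound A N a → Sound B (app (rename g M) N) (F g a)

Sound-≡ : ∀ {Γ A} {M M' : Tm Γ A} {v} → M ≡ M' → Sound A M v → Sound A M' v
Sound-≡ refl r = r

Sound-expand : ∀ {Γ} A {M M' : Tm Γ A} {v} → M' ⇝ M → Sound A M v → Sound A M' v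
Sound-expand (base n) e r = ⇝-trans e r
Sound-expand (A ⇒ B) e r g rN = Sound-expand B (⇝-app (⇝-rename g e) ⇝-refl) (r g rN)

Sound-rename : ∀ {Γ Δ} A (f : Ren Γ Δ) {M : Tm Γ A} {v} → Sound A M v → Sound A (rename f M) (renSem f v)
Sound-rename (base n) f {v = v} r =
  transport (_ ⇝_) (sym (embNf-renNf f v)) (⇝-rename f r)
Sound-rename (A ⇒ B) f {M} r g rN =
  Sound-≡ (cong (λ X → app X _) (sym (rename-rename f g M))) (r (λ x → g (f x)) rN)

mutual
  reify-Sound : ∀ {Γ} A {M : Tm Γ A} {v} → Sound A M v → M ⇝ embNf (reify v)
  reify-Sound (base n)        r = r
  reify-Sound (A ⇒ B) {M} r = ⇝-trans η-expand (⇝-lam (reify-Sound B (r S_ (reflect-Sound A ⇝-refl))))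
    where
    η-expand : M ⇝ lam (app (rename S_ M) (bvar Z))
    η-expand = ~sym (η M) , λ { (inlam (inl o)) → Occurs-rename⁻ S_ M o }
    ⇝-lam : ∀ {N N'} → N ⇝ N' → lam N ⇝ lam N'
    ⇝-lam (p , q) = ~lam p , λ { (inlam o) → inlam (q o) }

  reflect-Sound : ∀ {Γ} A {M : Tm Γ A} {n : Ne Γ A} → M ⇝ embNe n → Sound A M (reflect n)
  reflect-Sound (base k)          e = e
  reflect-Sound (A ⇒ B) {n = n} e g rN =
    reflect-Sound B (⇝-app (transport (_ ⇝_) (sym (embNe-renNe g n)) (⇝-rename g e)) (reify-Sound A rN))

infixr 5 _∷ˢ_
_∷ˢ_ : ∀ {Γ Δ B} → Tm Δ B → Sub Γ Δ → Sub (B ∷ Γ) Δ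
(N ∷ˢ σ) Z     = N
(N ∷ˢ σ) (S x) = σ x

extS-[]₀ : ∀ {Γ Δ Θ A B} (σ : Sub Γ Δ) (g : Ren Δ Θ) (N : Tm Θ B) (M : Tm (B ∷ Γ) A) →
           rename (extR g) (subst (extS σ) M) [ N ]₀ ≡ subst (N ∷ˢ λ x → rename g (σ x)) M
extS-[]₀ σ g N M = begin
  rename (extR g) (subst (extS σ) M) [ N ]₀
    ≡⟨ subst-rename (extR g) (single N) (subst (extS σ) M) ⟩
  subst (λ x → single N (extR g x)) (subst (extS σ) M)
    ≡⟨ subst-subst (extS σ) _ M ⟩
  subst (λ x → subst (λ y → single N (extR g y)) (extS σ x)) M
    ≡⟨ subst-cong (λ { Z → refl
                     ; (S x) → trans (subst-rename S_ _ (σ x)) (subst-bvar∘ g (λ y → refl) (σ x)) }) M ⟩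
  subst (N ∷ˢ λ x → rename g (σ x)) M
    ∎
  where open ≡-Reasoning

eval-Sound : ∀ {Γ Δ A} (M : Tm Γ A) (σ : Sub Γ Δ) (γ : Env Γ Δ) →
             (∀ {B} (x : Γ ∋ B) → Sound B (σ x) (γ x)) → Sound A (subst σ M) (eval M γ)
eval-Sound (bvar x)   σ γ h = h x
eval-Sound (fvar x A) σ γ h = reflect-Sound A ⇝-refl
eval-Sound (nom a A)  σ γ h = reflect-Sound A ⇝-refl
eval-Sound (con c A)  σ γ h = reflect-Sound A ⇝-refl
eval-Sound {A = A ⇒ B} (lam M) σ γ h g {N} {a} rN =
  Sound-expand B (β _ N , Occurs-[]₀⁻ _ N)
    (Sound-≡ (sym (extS-[]₀ σ g N M))
      (eval-Sound M (N ∷ˢ λ x → rename g (σ x)) (extE (renEnv g γ) a)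
                  λ { Z → rN ; (S x) → Sound-rename _ g (h x) }))
eval-Sound (app M N) σ γ h =
  Sound-≡ (cong (λ X → app X (subst σ N)) (rename-id (subst σ M)))
    (eval-Sound M σ γ h (λ x → x) (eval-Sound N σ γ h))

nf-sound : ∀ {Γ A} (M : Tm Γ A) → M ⇝ embNf (nf M)
nf-sound {A = A} M =
  reify-Sound A (Sound-≡ (subst-id M) (eval-Sound M bvar idEnv (λ {B} x → reflect-Sound B ⇝-refl)))

-- A Kripke partial equivalence; the uniformity conditions make evaluation commute with renaming.
SemEq : ∀ {Γ} A → Sem A Γ → Sem A Γ → Set
Uniform : ∀ {Γ} A B → Sem (A ⇒ B) Γ → Set
SemEq (base n)      v w = v ≡ w
SemEq {Γ} (A ⇒ B) F G =
  (∀ {Δ} (g : Ren Γ Δ) {a b} → SemEq A a b → SemEq B (F g a) (G g b)) × Uniform A B F × Uniform A B G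
Uniform {Γ} A B F = ∀ {Δ Θ} (g : Ren Γ Δ) (h : Ren Δ Θ) {a b} → SemEq A a b →
                    SemEq B (renSem h (F g a)) (F (λ x → h (g x)) (renSem h b))

SemEq-app : ∀ {Γ Δ A B} {F G : Sem (A ⇒ B) Γ} → SemEq (A ⇒ B) F G →
            (g : Ren Γ Δ) {a b : Sem A Δ} → SemEq A a b → SemEq B (F g a) (G g b)
SemEq-app e = proj₁ e

SemEq-uniformˡ : ∀ {Γ A B} {F G : Sem (A ⇒ B) Γ} → SemEq (A ⇒ B) F G → Uniform A B F
SemEq-uniformˡ e = proj₁ (proj₂ e)

SemEq-sym : ∀ {Γ} A {a b : Sem A Γ} → SemEq A a b → SemEq A b a
SemEq-sym (base n) e           = sym e
SemEq-sym (A ⇒ B)  (e , u , v) = (λ g ab → SemEq-sym B (e g (SemEq-sym A ab))) , v , u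

SemEq-trans : ∀ {Γ} A {a b c : Sem A Γ} → SemEq A a b → SemEq A b c → SemEq A a c
SemEq-trans (base n) e f                     = trans e f
SemEq-trans (A ⇒ B)  (e , u , _) (f , _ , w) =
  (λ g ac → SemEq-trans B (e g ac) (f g (SemEq-trans A (SemEq-sym A ac) ac))) , u , w

SemEq-reflˡ : ∀ {Γ} A {a b : Sem A Γ} → SemEq A a b → SemEq A a a
SemEq-reflˡ A e = SemEq-trans A e (SemEq-sym A e)

SemEq-rename : ∀ {Γ Δ} A (f : Ren Γ Δ) {a b} → SemEq A a b → SemEq A (renSem f a) (renSem f b)
SemEq-rename (base n) f e           = cong (renNf f) e
SemEq-rename (A ⇒ B)  f (e , u , v) = (λ g → e _) , (λ g → u _) , (λ g → v _)

renSem-id : ∀ {Γ} A {a b : Sem A Γ} → SemEq A a b → SemEq A (renSem (λ x → x) a) b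
renSem-id (base n) e = trans (renNf-id _) e
renSem-id (A ⇒ B)  e = e

renSem-renSem : ∀ {Γ Δ Θ} A (f : Ren Γ Δ) (h : Ren Δ Θ) {a b} → SemEq A a b →
                SemEq A (renSem h (renSem f a)) (renSem (λ x → h (f x)) b)
renSem-renSem (base n) f h {a} e = trans (renNf-renNf f h a) (cong (renNf _) e)
renSem-renSem (A ⇒ B)  f h e     = SemEq-rename (A ⇒ B) (λ x → h (f x)) e

reflect-cong : ∀ {Γ} A {m n : Ne Γ A} → m ≡ n → SemEq A (reflect m) (reflect m) → SemEq A (reflect m) (reflect n)
reflect-cong A refl e = e

mutual
  reflect-SemEq : ∀ {Γ} A (n : Ne Γ A) → SemEq A (reflect n) (reflect n)
  reflect-SemEq (base k) n = refl
  reflect-SemEq (A ⇒ B)  n = app-cong , uniform , uniform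
    where
    app-cong : ∀ {Δ} (g : Ren _ Δ) {a b} → SemEq A a b →
               SemEq B (reflect (napp (renNe g n) (reify a))) (reflect (napp (renNe g n) (reify b)))
    app-cong g ab = reflect-cong B (cong (napp (renNe g n)) (reify-SemEq A ab)) (reflect-SemEq B _)
    uniform : Uniform A B (reflect n)
    uniform g h {a} ab =
      SemEq-trans B (renSem-reflect B h (napp (renNe g n) (reify a)))
        (reflect-cong B (cong₂ napp (renNe-renNe g h n) (renNf-reify A h ab)) (reflect-SemEq B _))

  renSem-reflect : ∀ {Γ Δ} A (h : Ren Γ Δ) (n : Ne Γ A) → SemEq A (renSem h (reflect n)) (reflect (renNe h n))
  renSem-reflect (base k) h n = refl
  renSem-reflect (A ⇒ B)  h n =
    (λ g ab → reflect-cong B (cong₂ napp (sym (renNe-renNe h g n)) (reify-SemEq A ab)) (reflect-SemEq B _)) ,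
    (λ g → SemEq-uniformˡ (reflect-SemEq (A ⇒ B) n) _) ,
    SemEq-uniformˡ (reflect-SemEq (A ⇒ B) (renNe h n))

  reify-SemEq : ∀ {Γ} A {a b : Sem A Γ} → SemEq A a b → reify a ≡ reify b
  reify-SemEq (base n) e           = e
  reify-SemEq (A ⇒ B)  (e , _ , _) = cong nlam (reify-SemEq B (e S_ (reflect-SemEq A (nvar Z))))

  renNf-reify : ∀ {Γ Δ} A (h : Ren Γ Δ) {a b : Sem A Γ} → SemEq A a b → renNf h (reify a) ≡ reify (renSem h b)
  renNf-reify (base n) h e           = cong (renNf h) e
  renNf-reify (A ⇒ B)  h (e , u , v) = cong nlam (trans
    (renNf-reify B (extR h) (SemEq-reflˡ B (e S_ z)))
    (reify-SemEq B (SemEq-trans B (u S_ (extR h) z)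
      (e (λ x → S (h x)) (SemEq-trans A (renSem-reflect A (extR h) (nvar Z)) (reflect-SemEq A (nvar Z)))))))
    where
    z = reflect-SemEq A (nvar Z)

EnvEq : ∀ {Γ Δ} → Env Γ Δ → Env Γ Δ → Set
EnvEq {Γ} γ δ = ∀ {B} (x : Γ ∋ B) → SemEq B (γ x) (δ x)

EnvEq-reflˡ : ∀ {Γ Δ} {γ δ : Env Γ Δ} → EnvEq γ δ → EnvEq γ γ
EnvEq-reflˡ e x = SemEq-reflˡ _ (e x)

EnvEq-reflʳ : ∀ {Γ Δ} {γ δ : Env Γ Δ} → EnvEq γ δ → EnvEq δ δ
EnvEq-reflʳ e x = SemEq-reflˡ _ (SemEq-sym _ (e x))

EnvEq-sym : ∀ {Γ Δ} {γ δ : Env Γ Δ} → EnvEq γ δ → EnvEq δ γ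
EnvEq-sym e x = SemEq-sym _ (e x)

EnvEq-ext : ∀ {Γ Δ Θ A} {γ δ : Env Γ Δ} (g : Ren Δ Θ) {a b : Sem A Θ} → EnvEq γ δ → SemEq A a b →
            EnvEq (extE (renEnv g γ) a) (extE (renEnv g δ) b)
EnvEq-ext g e ab Z     = ab
EnvEq-ext g e ab (S x) = SemEq-rename _ g (e x)

mutual
  eval-SemEq : ∀ {Γ Δ A} (M : Tm Γ A) {γ δ : Env Γ Δ} → EnvEq γ δ → SemEq A (eval M γ) (eval M δ)
  eval-SemEq (bvar x)   e = e x
  eval-SemEq (fvar x A) e = reflect-SemEq A _
  eval-SemEq (nom a A)  e = reflect-SemEq A _
  eval-SemEq (con c A)  e = reflect-SemEq A _
  eval-SemEq (lam M) {γ} {δ} e =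
    (λ g ab → eval-SemEq M (EnvEq-ext g e ab)) ,
    eval-lam-Uniform M γ (EnvEq-reflˡ e) , eval-lam-Uniform M δ (EnvEq-reflʳ e)
  eval-SemEq (app M N)  e = SemEq-app (eval-SemEq M e) (λ x → x) (eval-SemEq N e)

  eval-lam-Uniform : ∀ {Γ Δ A B} (M : Tm (A ∷ Γ) B) (γ : Env Γ Δ) → EnvEq γ γ → Uniform A B (eval (lam M) γ)
  eval-lam-Uniform {A = A} {B} M γ e g h ab =
    SemEq-trans B (renSem-eval M h (EnvEq-ext g e (SemEq-reflˡ A ab)))
      (eval-SemEq M (λ { Z → SemEq-rename A h ab ; (S x) → renSem-renSem _ g h (e x) }))

  renSem-eval : ∀ {Γ Δ Θ A} (M : Tm Γ A) (h : Ren Δ Θ) {γ δ : Env Γ Δ} → EnvEq γ δ →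
                SemEq A (renSem h (eval M γ)) (eval M (renEnv h δ))
  renSem-eval (bvar x)   h e = SemEq-rename _ h (e x)
  renSem-eval (fvar x A) h e = renSem-reflect A h _
  renSem-eval (nom a A)  h e = renSem-reflect A h _
  renSem-eval (con c A)  h e = renSem-reflect A h _
  renSem-eval (lam M) h {γ} {δ} e =
    (λ g ab → eval-SemEq M (λ { Z → ab ; (S x) → SemEq-sym _ (renSem-renSem _ h g (SemEq-sym _ (e x))) })) ,
    (λ g → eval-lam-Uniform M γ (EnvEq-reflˡ e) _) ,
    eval-lam-Uniform M (renEnv h δ) (λ x → SemEq-rename _ h (EnvEq-reflʳ e x))
  renSem-eval {A = B} (app M N) h e =
    SemEq-trans B (SemEq-uniformˡ (eval-SemEq M (EnvEq-reflˡ e)) (λ x → x) h (eval-SemEq N (EnvEq-reflˡ e)))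
      (SemEq-app (renSem-eval M h e) (λ x → x) (renSem-eval N h e))

eval-rename : ∀ {Γ Γ' Δ A} (M : Tm Γ A) (f : Ren Γ Γ') {γ δ : Env Γ' Δ} → EnvEq γ δ →
              SemEq A (eval (rename f M) γ) (eval M (λ x → δ (f x)))
eval-rename (bvar x)   f e = e (f x)
eval-rename (fvar x A) f e = reflect-SemEq A _
eval-rename (nom a A)  f e = reflect-SemEq A _
eval-rename (con c A)  f e = reflect-SemEq A _
eval-rename {A = A ⇒ B} (lam M) f {γ} {δ} e =
  (λ g ab → SemEq-trans B (eval-rename M (extR f) (EnvEq-ext g e ab))
     (eval-SemEq M (λ { Z → SemEq-reflˡ A (SemEq-sym A ab)
                      ; (S x) → SemEq-rename _ g (EnvEq-reflʳ e (f x)) }))) ,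
  eval-lam-Uniform (rename (extR f) M) γ (EnvEq-reflˡ e) ,
  eval-lam-Uniform M (λ x → δ (f x)) (λ x → EnvEq-reflʳ e (f x))
eval-rename (app M N)  f e = SemEq-app (eval-rename M f e) (λ x → x) (eval-rename N f e)

eval-subst : ∀ {Γ Γ' Δ A} (M : Tm Γ A) (σ : Sub Γ Γ') {γ δ : Env Γ' Δ} → EnvEq γ δ →
             SemEq A (eval (subst σ M) γ) (eval M (λ x → eval (σ x) δ))
eval-subst (bvar x)   σ e = eval-SemEq (σ x) e
eval-subst (fvar x A) σ e = reflect-SemEq A _
eval-subst (nom a A)  σ e = reflect-SemEq A _
eval-subst (con c A)  σ e = reflect-SemEq A _
eval-subst {A = A ⇒ B} (lam M) σ {γ} {δ} e =
  (λ g ab → SemEq-trans B (eval-subst M (extS σ) (EnvEq-ext g e ab))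
     (eval-SemEq M (λ { Z → SemEq-reflˡ A (SemEq-sym A ab)
                      ; (S x) → SemEq-trans _ (eval-rename (σ x) S_ (EnvEq-reflʳ (EnvEq-ext g e ab)))
                                              (SemEq-sym _ (renSem-eval (σ x) g (EnvEq-reflʳ e))) }))) ,
  eval-lam-Uniform (subst (extS σ) M) γ (EnvEq-reflˡ e) ,
  eval-lam-Uniform M (λ x → eval (σ x) δ) (λ x → eval-SemEq (σ x) (EnvEq-reflʳ e))
eval-subst (app M N)  σ e = SemEq-app (eval-subst M σ e) (λ x → x) (eval-subst N σ e)

~⇒eval-SemEq : ∀ {Γ Δ A} {M N : Tm Γ A} → M ~ N → {γ δ : Env Γ Δ} → EnvEq γ δ →
               SemEq A (eval M γ) (eval N δ)
~⇒eval-SemEq {A = A} (β M N) e =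
  SemEq-sym A (SemEq-trans A (eval-subst M (single N) (EnvEq-reflʳ e))
    (eval-SemEq M (λ { Z → SemEq-sym _ (eval-SemEq N e) ; (S x) → SemEq-sym _ (renSem-id _ (e x)) })))
~⇒eval-SemEq {A = A ⇒ B} (η M) {γ} e =
  (λ g ab → SemEq-trans B (SemEq-app (eval-rename M S_ (EnvEq-reflˡ (EnvEq-ext g e ab))) (λ x → x) ab)
     (SemEq-app (SemEq-sym (A ⇒ B) (renSem-eval M g (EnvEq-sym e))) (λ x → x) (SemEq-reflˡ A (SemEq-sym A ab)))) ,
  eval-lam-Uniform (app (rename S_ M) (bvar Z)) γ (EnvEq-reflˡ e) ,
  SemEq-uniformˡ (eval-SemEq M (EnvEq-reflʳ e))
~⇒eval-SemEq (~refl {M = M}) e         = eval-SemEq M e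
~⇒eval-SemEq {A = A} (~sym p) e       = SemEq-sym A (~⇒eval-SemEq p (EnvEq-sym e))
~⇒eval-SemEq {A = A} (~trans p q) e   = SemEq-trans A (~⇒eval-SemEq p e) (~⇒eval-SemEq q (EnvEq-reflʳ e))
~⇒eval-SemEq (~lam {M = M} {M'} p) {γ} {δ} e =
  (λ g ab → ~⇒eval-SemEq p (EnvEq-ext g e ab)) ,
  eval-lam-Uniform M γ (EnvEq-reflˡ e) , eval-lam-Uniform M' δ (EnvEq-reflʳ e)
~⇒eval-SemEq (~app p q) e              = SemEq-app (~⇒eval-SemEq p e) (λ x → x) (~⇒eval-SemEq q e)

~⇒nf≡ : ∀ {Γ A} {M N : Tm Γ A} → M ~ N → nf M ≡ nf N
~⇒nf≡ {A = A} p = reify-SemEq A (~⇒eval-SemEq p (λ x → reflect-SemEq _ (nvar x)))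

-- Permutations of nominal constants

·-rename : ∀ {Γ Δ A} (π : Perm) (f : Ren Γ Δ) (M : Tm Γ A) → π · rename f M ≡ rename f (π · M)
·-rename π f (bvar x)   = refl
·-rename π f (fvar x A) = refl
·-rename π f (nom a A)  = refl
·-rename π f (con c A)  = refl
·-rename π f (lam M)    = cong lam (·-rename π (extR f) M)
·-rename π f (app M N)  = cong₂ app (·-rename π f M) (·-rename π f N)

·-subst : ∀ {Γ Δ A} (π : Perm) (σ : Sub Γ Δ) (M : Tm Γ A) → π · subst σ M ≡ subst (λ x → π · σ x) (π · M)
·-subst π σ (bvar x)   = refl
·-subst π σ (fvar x A) = refl
·-subst π σ (nom a A)  = refl
·-subst π σ (con c A)  = refl
·-subst π σ (lam M)    = cong lam (trans (·-subst π (extS σ) M)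
                                         (subst-cong (λ { Z → refl ; (S x) → ·-rename π S_ (σ x) }) (π · M)))
·-subst π σ (app M N)  = cong₂ app (·-subst π σ M) (·-subst π σ N)

~-perm : ∀ {Γ A} (π : Perm) {M N : Tm Γ A} → M ~ N → π · M ~ π · N
~-perm π (β M N) = transport (app (lam (π · M)) (π · N) ~_)
  (sym (trans (·-subst π (single N) M) (subst-cong (λ { Z → refl ; (S x) → refl }) (π · M))))
  (β (π · M) (π · N))
~-perm π (η M) = transport (λ X → lam (app X (bvar Z)) ~ π · M) (sym (·-rename π S_ M)) (η (π · M))
~-perm π ~refl        = ~refl
~-perm π (~sym p)     = ~sym (~-perm π p)
~-perm π (~trans p q) = ~trans (~-perm π p) (~-perm π q)
~-perm π (~lam p)     = ~lam (~-perm π p)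
~-perm π (~app p q)   = ~app (~-perm π p) (~-perm π q)

·-cong-Occurs : ∀ {Γ A} (π π' : Perm) (M : Tm Γ A) →
                (∀ {a C} → Occurs a C M → to π C a ≡ to π' C a) → π · M ≡ π' · M
·-cong-Occurs π π' (bvar x)   h = refl
·-cong-Occurs π π' (fvar x A) h = refl
·-cong-Occurs π π' (nom a A)  h = cong (λ b → nom b A) (h here)
·-cong-Occurs π π' (con c A)  h = refl
·-cong-Occurs π π' (lam M)    h = cong lam (·-cong-Occurs π π' M (λ o → h (inlam o)))
·-cong-Occurs π π' (app M N)  h =
  cong₂ app (·-cong-Occurs π π' M (λ o → h (inl o))) (·-cong-Occurs π π' N (λ o → h (inr o)))

·-fix-Occurs : ∀ {Γ A} (π : Perm) (M : Tm Γ A) → (∀ {a C} → Occurs a C M → to π C a ≡ a) → π · M ≡ M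
·-fix-Occurs π (bvar x)   h = refl
·-fix-Occurs π (fvar x A) h = refl
·-fix-Occurs π (nom a A)  h = cong (λ b → nom b A) (h here)
·-fix-Occurs π (con c A)  h = refl
·-fix-Occurs π (lam M)    h = cong lam (·-fix-Occurs π M (λ o → h (inlam o)))
·-fix-Occurs π (app M N)  h =
  cong₂ app (·-fix-Occurs π M (λ o → h (inl o))) (·-fix-Occurs π N (λ o → h (inr o)))

Occurs-·⁻ : ∀ {Γ A} (π : Perm) (M : Tm Γ A) {a C} → Occurs a C (π · M) →
            Σ ℕ λ b → (to π C b ≡ a) × Occurs b C M
Occurs-·⁻ π (nom b A) here = b , refl , here
Occurs-·⁻ π (lam M) (inlam o) with Occurs-·⁻ π M o
... | b , e , p = b , e , inlam p
Occurs-·⁻ π (app M N) (inl o) with Occurs-·⁻ π M o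
... | b , e , p = b , e , inl p
Occurs-·⁻ π (app M N) (inr o) with Occurs-·⁻ π N o
... | b , e , p = b , e , inr p

idₚ : Perm
idₚ = record
  { to = λ _ a → a ; from = λ _ a → a ; from∘to = λ _ _ → refl ; to∘from = λ _ _ → refl
  ; dom = [] ; finite = λ _ _ _ → refl }

_⁻¹ₚ : Perm → Perm
π ⁻¹ₚ = record
  { to = from π ; from = to π ; from∘to = to∘from π ; to∘from = from∘to π
  ; dom = Perm.dom π
  ; finite = λ a A a∉ → trans (cong (from π A) (sym (Perm.finite π a A a∉))) (from∘to π A a) }

infixr 9 _∘ₚ_
_∘ₚ_ : Perm → Perm → Perm
π ∘ₚ ρ = record
  { to      = λ C a → to π C (to ρ C a)
  ; from    = λ C a → from ρ C (from π C a)
  ; from∘to = λ C a → trans (cong (from ρ C) (from∘to π C (to ρ C a))) (from∘to ρ C a)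
  ; to∘from = λ C a → trans (cong (to π C) (to∘from ρ C (from π C a))) (to∘from π C a)
  ; dom     = Perm.dom π ++ Perm.dom ρ
  ; finite  = λ a A a∉ → trans (cong (to π A) (Perm.finite ρ a A (λ m → a∉ (∈-++⁺ʳ (Perm.dom π) m))))
                                (Perm.finite π a A (λ m → a∉ (∈-++⁺ˡ m))) }

∘ₚ-· : ∀ {Γ A} (π ρ : Perm) (M : Tm Γ A) → (π ∘ₚ ρ) · M ≡ π · (ρ · M)
∘ₚ-· π ρ (bvar x)   = refl
∘ₚ-· π ρ (fvar x A) = refl
∘ₚ-· π ρ (nom a A)  = refl
∘ₚ-· π ρ (con c A)  = refl
∘ₚ-· π ρ (lam M)    = cong lam (∘ₚ-· π ρ M)
∘ₚ-· π ρ (app M N)  = cong₂ app (∘ₚ-· π ρ M) (∘ₚ-· π ρ N)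

⁻¹ₚ-· : ∀ {Γ A} (π : Perm) (M : Tm Γ A) → π ⁻¹ₚ · (π · M) ≡ M
⁻¹ₚ-· π (bvar x)   = refl
⁻¹ₚ-· π (fvar x A) = refl
⁻¹ₚ-· π (nom a A)  = cong (λ b → nom b A) (from∘to π A a)
⁻¹ₚ-· π (con c A)  = refl
⁻¹ₚ-· π (lam M)    = cong lam (⁻¹ₚ-· π M)
⁻¹ₚ-· π (app M N)  = cong₂ app (⁻¹ₚ-· π M) (⁻¹ₚ-· π N)

≈-sym : ∀ {A} {X Y : Term A} → X ≈ Y → Y ≈ X
≈-sym {Y = Y} (π , p) = π ⁻¹ₚ , transport (_~ π ⁻¹ₚ · _) (⁻¹ₚ-· π Y) (~sym (~-perm (π ⁻¹ₚ) p))

≈-trans : ∀ {A} {X Y W : Term A} → X ≈ Y → Y ≈ W → X ≈ W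
≈-trans {W = W} (π , p) (ρ , q) = π ∘ₚ ρ , ~trans p (transport (π · _ ~_) (sym (∘ₚ-· π ρ W)) (~-perm π q))

~-≈-trans : ∀ {A} {X Y W : Term A} → X ~ Y → Y ≈ W → X ≈ W
~-≈-trans p (π , q) = π , ~trans p q

rename-[θ] : ∀ {Γ Δ A} (θ : Subst) (f : Ren Γ Δ) (M : Tm Γ A) → rename f (M [ θ ]) ≡ rename f M [ θ ]
rename-[θ] θ f (bvar x)   = refl
rename-[θ] θ f (fvar x A) =
  trans (rename-rename (λ ()) f (Subst.map θ x A)) (rename-cong (λ ()) (Subst.map θ x A))
rename-[θ] θ f (nom a A)  = refl
rename-[θ] θ f (con c A)  = refl
rename-[θ] θ f (lam M)    = cong lam (rename-[θ] θ (extR f) M)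
rename-[θ] θ f (app M N)  = cong₂ app (rename-[θ] θ f M) (rename-[θ] θ f N)

subst-[θ] : ∀ {Γ Δ A} (θ : Subst) (σ : Sub Γ Δ) (M : Tm Γ A) →
            subst σ M [ θ ] ≡ subst (λ x → σ x [ θ ]) (M [ θ ])
subst-[θ] θ σ (bvar x)   = refl
subst-[θ] θ σ (fvar x A) =
  sym (trans (subst-rename (λ ()) _ (Subst.map θ x A)) (subst-bvar∘ _ (λ ()) (Subst.map θ x A)))
subst-[θ] θ σ (nom a A)  = refl
subst-[θ] θ σ (con c A)  = refl
subst-[θ] θ σ (lam M)    = cong lam (trans (subst-[θ] θ (extS σ) M)
  (subst-cong (λ { Z → refl ; (S x) → sym (rename-[θ] θ S_ (σ x)) }) (M [ θ ])))
subst-[θ] θ σ (app M N)  = cong₂ app (subst-[θ] θ σ M) (subst-[θ] θ σ N)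

~-[θ] : ∀ {Γ A} (θ : Subst) {M N : Tm Γ A} → M ~ N → M [ θ ] ~ N [ θ ]
~-[θ] θ (β M N) = transport (app (lam (M [ θ ])) (N [ θ ]) ~_)
  (sym (trans (subst-[θ] θ (single N) M) (subst-cong (λ { Z → refl ; (S x) → refl }) (M [ θ ]))))
  (β (M [ θ ]) (N [ θ ]))
~-[θ] θ (η M) = transport (λ X → lam (app X (bvar Z)) ~ M [ θ ]) (rename-[θ] θ S_ M) (η (M [ θ ]))
~-[θ] θ ~refl        = ~refl
~-[θ] θ (~sym p)     = ~sym (~-[θ] θ p)
~-[θ] θ (~trans p q) = ~trans (~-[θ] θ p) (~-[θ] θ q)
~-[θ] θ (~lam p)     = ~lam (~-[θ] θ p)
~-[θ] θ (~app p q)   = ~app (~-[θ] θ p) (~-[θ] θ q)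

[]-cong-~ : ∀ {Γ A} {θ θ' : Subst} → (∀ x B → Subst.map θ x B ~ Subst.map θ' x B) →
            (M : Tm Γ A) → M [ θ ] ~ M [ θ' ]
[]-cong-~ h (bvar x)   = ~refl
[]-cong-~ h (fvar x A) = ~-rename (λ ()) (h x A)
[]-cong-~ h (nom a A)  = ~refl
[]-cong-~ h (con c A)  = ~refl
[]-cong-~ h (lam M)    = ~lam ([]-cong-~ h M)
[]-cong-~ h (app M N)  = ~app ([]-cong-~ h M) ([]-cong-~ h N)

infixr 6 _·ˢ_
_·ˢ_ : Perm → Subst → Subst
π ·ˢ θ = record
  { map = λ x A → π · Subst.map θ x A ; dom = Subst.dom θ
  ; finite = λ x A x∉ → cong (π ·_) (Subst.finite θ x A x∉) }

·-[θ] : ∀ {Γ A} (π : Perm) (θ : Subst) (M : Tm Γ A) → π · (M [ θ ]) ≡ (π · M) [ π ·ˢ θ ]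
·-[θ] π θ (bvar x)   = refl
·-[θ] π θ (fvar x A) = ·-rename π (λ ()) (Subst.map θ x A)
·-[θ] π θ (nom a A)  = refl
·-[θ] π θ (con c A)  = refl
·-[θ] π θ (lam M)    = cong lam (·-[θ] π θ M)
·-[θ] π θ (app M N)  = cong₂ app (·-[θ] π θ M) (·-[θ] π θ N)

-- The support of a term

_≟ᵀ_ : DecidableEquality Ty
base n ≟ᵀ base m with n ℕ.≟ m
... | yes refl = yes refl
... | no n≢m   = no λ { refl → n≢m refl }
base n  ≟ᵀ (B ⇒ C) = no λ ()
(A ⇒ B) ≟ᵀ base m  = no λ ()
(A ⇒ B) ≟ᵀ (C ⇒ D) with A ≟ᵀ C | B ≟ᵀ D
... | yes refl | yes refl = yes refl
... | no A≢C   | _        = no λ { refl → A≢C refl }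
... | yes _    | no B≢D   = no λ { refl → B≢D refl }

_≟ᴺ_ : DecidableEquality (ℕ × Ty)
_≟ᴺ_ = ≡-dec ℕ._≟_ _≟ᵀ_

open import Data.List.Membership.DecPropositional _≟ᴺ_ using (_∈?_)
open import Data.List.Relation.Unary.Unique.DecPropositional.Properties _≟ᴺ_ using (deduplicate-!)

nominals : ∀ {Γ A} → Tm Γ A → List (ℕ × Ty)
nominals (bvar x)   = []
nominals (fvar x A) = []
nominals (nom a A)  = (a , A) ∷ []
nominals (con c A)  = []
nominals (lam M)    = nominals M
nominals (app M N)  = nominals M ++ nominals N

∈-nominals⁺ : ∀ {Γ A} (M : Tm Γ A) {a C} → Occurs a C M → (a , C) ∈ nominals M
∈-nominals⁺ (nom a A) here      = here refl
∈-nominals⁺ (lam M)   (inlam o) = ∈-nominals⁺ M o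
∈-nominals⁺ (app M N) (inl o)   = ∈-++⁺ˡ (∈-nominals⁺ M o)
∈-nominals⁺ (app M N) (inr o)   = ∈-++⁺ʳ (nominals M) (∈-nominals⁺ N o)

∈-nominals⁻ : ∀ {Γ A} (M : Tm Γ A) {a C} → (a , C) ∈ nominals M → Occurs a C M
∈-nominals⁻ (nom a A) (here refl) = here
∈-nominals⁻ (lam M)   m           = inlam (∈-nominals⁻ M m)
∈-nominals⁻ (app M N) m with ∈-++⁻ (nominals M) m
... | inj₁ m' = inl (∈-nominals⁻ M m')
... | inj₂ m' = inr (∈-nominals⁻ N m')

Occurs-nf⇒InSupp : ∀ {A} (M : Term A) {a C} → Occurs a C (embNf (nf M)) → InSupp a C M
Occurs-nf⇒InSupp M {a} {C} o t' M~t' =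
  proj₂ (nf-sound t') (transport (λ v → Occurs a C (embNf v)) (~⇒nf≡ M~t') o)

InSupp⇒Occurs : ∀ {A} {M : Term A} {a C} → InSupp a C M → Occurs a C M
InSupp⇒Occurs ins = ins _ ~refl

·-cong-InSupp : ∀ {A} (π π' : Perm) (M : Term A) →
                (∀ {a C} → InSupp a C M → to π C a ≡ to π' C a) → π · M ~ π' · M
·-cong-InSupp π π' M h = begin
  π · M                 ∼⟨ ~-perm π (proj₁ (nf-sound M)) ⟩
  π · embNf (nf M)      ≡⟨ ·-cong-Occurs π π' (embNf (nf M)) (λ o → h (Occurs-nf⇒InSupp M o)) ⟩
  π' · embNf (nf M)     ∼⟨ ~-perm π' (~sym (proj₁ (nf-sound M))) ⟩
  π' · M                ∎
  where open ~-Reasoning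

·-fix-InSupp : ∀ {A} (π : Perm) (M : Term A) → (∀ {a C} → InSupp a C M → to π C a ≡ a) → π · M ~ M
·-fix-InSupp π M h = begin
  π · M                 ∼⟨ ~-perm π (proj₁ (nf-sound M)) ⟩
  π · embNf (nf M)      ≡⟨ ·-fix-Occurs π (embNf (nf M)) (λ o → h (Occurs-nf⇒InSupp M o)) ⟩
  embNf (nf M)          ∼⟨ ~sym (proj₁ (nf-sound M)) ⟩
  M                     ∎
  where open ~-Reasoning

InSupp-· : ∀ {A} {t t' : Term A} (ρ : Perm) → t ~ ρ · t' → ∀ {a C} → InSupp a C t' → InSupp (to ρ C a) C t
InSupp-· {t' = t'} ρ t~ρt' {a} {C} ins u t~u = moved (Occurs-·⁻ (ρ ⁻¹ₚ) u (ins (ρ ⁻¹ₚ · u) t'~ρ⁻¹u))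
  where
  t'~ρ⁻¹u : t' ~ ρ ⁻¹ₚ · u
  t'~ρ⁻¹u = transport (_~ ρ ⁻¹ₚ · u) (⁻¹ₚ-· ρ t') (~-perm (ρ ⁻¹ₚ) (~trans (~sym t~ρt') t~u))
  moved : (Σ ℕ λ b → (from ρ C b ≡ a) × Occurs b C u) → Occurs (to ρ C a) C u
  moved (b , ρ⁻¹b≡a , o) = transport (λ c → Occurs c C u) (trans (sym (to∘from ρ C b)) (cong (to ρ C) ρ⁻¹b≡a)) o

supp : ∀ {A} → Term A → List (ℕ × Ty)
supp M = deduplicate _≟ᴺ_ (nominals (embNf (nf M)))

supp-unique : ∀ {A} (M : Term A) → Unique (supp M)
supp-unique M = deduplicate-! (nominals (embNf (nf M)))

∈-supp⁻ : ∀ {A} (M : Term A) {a C} → (a , C) ∈ supp M → InSupp a C M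
∈-supp⁻ M m = Occurs-nf⇒InSupp M (∈-nominals⁻ _ (∈-deduplicate⁻ _≟ᴺ_ _ m))

∈-supp⁺ : ∀ {A} (M : Term A) {a C} → InSupp a C M → (a , C) ∈ supp M
∈-supp⁺ M ins = ∈-deduplicate⁺ _≟ᴺ_ (∈-nominals⁺ _ (ins _ (proj₁ (nf-sound M))))

-- Transpositions and renaming apart

∈-∉⇒≢ : ∀ {xs : List (ℕ × Ty)} {p q} → q ∈ xs → p ∉ xs → q ≢ p
∈-∉⇒≢ q∈ p∉ refl = p∉ q∈

swap : ℕ → ℕ → Ty → Ty → ℕ → ℕ
swap u v A C x with (x , C) ≟ᴺ (u , A)
... | yes _ = v
... | no _ with (x , C) ≟ᴺ (v , A)
...   | yes _ = u
...   | no _  = x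

swap-left : ∀ u v A → swap u v A A u ≡ v
swap-left u v A with (u , A) ≟ᴺ (u , A)
... | yes _   = refl
... | no u≢u  = ⊥-elim (u≢u refl)

swap-right : ∀ u v A → swap u v A A v ≡ u
swap-right u v A with (v , A) ≟ᴺ (u , A)
... | yes v≡u = cong proj₁ v≡u
... | no _ with (v , A) ≟ᴺ (v , A)
...   | yes _  = refl
...   | no v≢v = ⊥-elim (v≢v refl)

swap-other : ∀ u v A C x → (x , C) ≢ (u , A) → (x , C) ≢ (v , A) → swap u v A C x ≡ x
swap-other u v A C x x≢u x≢v with (x , C) ≟ᴺ (u , A)
... | yes x≡u = ⊥-elim (x≢u x≡u)
... | no _ with (x , C) ≟ᴺ (v , A)
...   | yes x≡v = ⊥-elim (x≢v x≡v)
...   | no _    = refl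

swap-involutive : ∀ u v A C x → swap u v A C (swap u v A C x) ≡ x
swap-involutive u v A C x = by-cases ((x , C) ≟ᴺ (u , A)) ((x , C) ≟ᴺ (v , A))
  where
  by-cases : Dec ((x , C) ≡ (u , A)) → Dec ((x , C) ≡ (v , A)) → swap u v A C (swap u v A C x) ≡ x
  by-cases (yes refl) _          = trans (cong (swap u v A A) (swap-left u v A)) (swap-right u v A)
  by-cases (no _)     (yes refl) = trans (cong (swap u v A A) (swap-right u v A)) (swap-left u v A)
  by-cases (no x≢u)   (no x≢v)   =
    trans (cong (swap u v A C) (swap-other u v A C x x≢u x≢v)) (swap-other u v A C x x≢u x≢v)

transposition : ℕ → ℕ → Ty → Perm
transposition u v A = record
  { to = swap u v A ; from = swap u v A ; from∘to = swap-involutive u v A ; to∘from = swap-involutive u v A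
  ; dom = (u , A) ∷ (v , A) ∷ []
  ; finite = λ x C x∉ → swap-other u v A C x (λ e → x∉ (here e)) (λ e → x∉ (there (here e))) }

swaps : List (ℕ × ℕ × Ty) → Perm
swaps []                  = idₚ
swaps ((u , v , A) ∷ ps) = transposition u v A ∘ₚ swaps ps

swapped : List (ℕ × ℕ × Ty) → List (ℕ × Ty)
swapped []                  = []
swapped ((u , v , A) ∷ ps) = (u , A) ∷ (v , A) ∷ swapped ps

-- Each transposition touches constants not involved in the later ones, so they act independently.
Separated : List (ℕ × ℕ × Ty) → Set
Separated []                  = ⊤
Separated ((u , v , A) ∷ ps) = ((u , A) ∉ swapped ps) × ((v , A) ∉ swapped ps) × Separated ps

∈⇒∈-swapped : ∀ ps {u v A} → (u , v , A) ∈ ps → ((u , A) ∈ swapped ps) × ((v , A) ∈ swapped ps)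
∈⇒∈-swapped (p ∷ ps)          (here refl) = here refl , there (here refl)
∈⇒∈-swapped ((u , v , A) ∷ ps) (there m) with ∈⇒∈-swapped ps m
... | m₁ , m₂ = there (there m₁) , there (there m₂)

swaps-fix : ∀ ps {x C} → (x , C) ∉ swapped ps → to (swaps ps) C x ≡ x
swaps-fix []                  x∉ = refl
swaps-fix ((u , v , A) ∷ ps) {x} {C} x∉ =
  trans (cong (swap u v A C) (swaps-fix ps (λ m → x∉ (there (there m)))))
        (swap-other u v A C x (λ e → x∉ (here e)) (λ e → x∉ (there (here e))))

swaps-left : ∀ ps → Separated ps → ∀ {u v A} → (u , v , A) ∈ ps → to (swaps ps) A u ≡ v
swaps-left ((u , v , A) ∷ ps) (u∉ , v∉ , sep) (here refl) =
  trans (cong (swap u v A A) (swaps-fix ps u∉)) (swap-left u v A)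
swaps-left ((u , v , A) ∷ ps) (u∉ , v∉ , sep) {A = A'} (there m) =
  trans (cong (swap u v A A') (swaps-left ps sep m))
        (swap-other u v A A' _ (∈-∉⇒≢ v'∈ u∉) (∈-∉⇒≢ v'∈ v∉))
  where v'∈ = proj₂ (∈⇒∈-swapped ps m)

swaps-right : ∀ ps → Separated ps → ∀ {u v A} → (u , v , A) ∈ ps → to (swaps ps) A v ≡ u
swaps-right ((u , v , A) ∷ ps) (u∉ , v∉ , sep) (here refl) =
  trans (cong (swap u v A A) (swaps-fix ps v∉)) (swap-right u v A)
swaps-right ((u , v , A) ∷ ps) (u∉ , v∉ , sep) {A = A'} (there m) =
  trans (cong (swap u v A A') (swaps-right ps sep m))
        (swap-other u v A A' _ (∈-∉⇒≢ u'∈ u∉) (∈-∉⇒≢ u'∈ v∉))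
  where u'∈ = proj₁ (∈⇒∈-swapped ps m)

Below : ℕ → List (ℕ × Ty) → Set
Below k xs = ∀ {b C} → (b , C) ∈ xs → b < k

freshPairs : ℕ → List (ℕ × Ty) → List (ℕ × ℕ × Ty)
freshPairs k []            = []
freshPairs k ((a , D) ∷ L) = (a , k , D) ∷ freshPairs (suc k) L

∈-swapped-freshPairs⁻ : ∀ k L {b C} → (b , C) ∈ swapped (freshPairs k L) → ((b , C) ∈ L) ⊎ (k ≤ b)
∈-swapped-freshPairs⁻ k ((a , D) ∷ L) (here e)            = inj₁ (here e)
∈-swapped-freshPairs⁻ k ((a , D) ∷ L) (there (here refl)) = inj₂ ≤-refl
∈-swapped-freshPairs⁻ k ((a , D) ∷ L) (there (there m)) with ∈-swapped-freshPairs⁻ (suc k) L m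
... | inj₁ m' = inj₁ (there m')
... | inj₂ le = inj₂ (≤-trans (n≤1+n k) le)

freshPairs-separated : ∀ k L → Unique L → Below k L → Separated (freshPairs k L)
freshPairs-separated k []            _          _  = tt
freshPairs-separated k ((a , D) ∷ L) (a∉ ∷ uL) bL =
  a-fresh , k-fresh , freshPairs-separated (suc k) L uL (λ m → m<n⇒m<1+n (bL (there m)))
  where
  a-fresh : (a , D) ∉ swapped (freshPairs (suc k) L)
  a-fresh m with ∈-swapped-freshPairs⁻ (suc k) L m
  ... | inj₁ m' = All.lookup a∉ m' refl
  ... | inj₂ le = <-asym (bL (here refl)) le
  k-fresh : (k , D) ∉ swapped (freshPairs (suc k) L)
  k-fresh m with ∈-swapped-freshPairs⁻ (suc k) L m
  ... | inj₁ m' = <-irrefl refl (bL (there m'))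
  ... | inj₂ le = <-irrefl refl le

act : Perm → ℕ × Ty → ℕ × Ty
act π (a , C) = to π C a , C

act-injective : ∀ (π : Perm) {p q} → act π p ≡ act π q → p ≡ q
act-injective π {a , C} {b , D} e with cong proj₂ e
... | refl = cong (_, C) (begin
  a                       ≡⟨ from∘to π C a ⟨
  from π C (to π C a)     ≡⟨ cong (from π C ∘ proj₁) e ⟩
  from π C (to π C b)     ≡⟨ from∘to π C b ⟩
  b                       ∎)
  where open ≡-Reasoning

freshPairs-aligned : ∀ (π : Perm) k L {a C} → (a , C) ∈ L →
  Σ ℕ λ m → ((a , m , C) ∈ freshPairs k L) × ((to π C a , m , C) ∈ freshPairs k (List.map (act π) L))
freshPairs-aligned π k ((a , D) ∷ L) (here refl) = k , here refl , here refl
freshPairs-aligned π k ((a , D) ∷ L) (there m) with freshPairs-aligned π (suc k) L m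
... | n , m₁ , m₂ = n , there m₁ , there m₂

-- Independence of the choice of the renaming permutation

rangeNominals : Subst → List (ℕ × Ty)
rangeNominals θ = List.concatMap (λ p → nominals (Subst.map θ (proj₁ p) (proj₂ p))) (Subst.dom θ)

∈-rangeNominals⁺ : ∀ θ {x B b C} → Occurs b C (Subst.map θ x B) → (b , C) ∈ rangeNominals θ
∈-rangeNominals⁺ θ {x} {B} {b} {C} o with (x , B) ∈? Subst.dom θ
... | yes x∈ = ∈-concatMap⁺ _ (lose x∈ (∈-nominals⁺ _ o))
... | no x∉  with transport (Occurs b C) (Subst.finite θ x B x∉) o
...   | ()

Below-suc-max : ∀ xs → Below (suc (max 0 (List.map proj₁ xs))) xs
Below-suc-max xs m = s≤s (All.lookup (xs≤max 0 (List.map proj₁ xs)) (∈-map⁺ proj₁ m))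

nca-≈-fresh : ∀ {A} (M : Term A) (θ : Subst) (π : Perm) → Avoids π M θ → ∀ k →
               Below k (supp M) → Below k (List.map (act π) (supp M)) → Below k (rangeNominals θ) →
               nca M θ π ≈ nca M θ (swaps (freshPairs k (supp M)))
nca-≈-fresh M θ π avoids k M<k πM<k θ<k = σ , (begin
  nca M θ π                   ∼⟨ ~-[θ] θ (·-cong-InSupp π (σ ∘ₚ κ) M σκ-agrees) ⟩
  ((σ ∘ₚ κ) · M) [ θ ]        ∼⟨ []-cong-~ {θ = θ} {σ ·ˢ θ} θ~σθ ((σ ∘ₚ κ) · M) ⟩
  ((σ ∘ₚ κ) · M) [ σ ·ˢ θ ]   ≡⟨ cong (_[ σ ·ˢ θ ]) (∘ₚ-· σ κ M) ⟩
  (σ · (κ · M)) [ σ ·ˢ θ ]    ≡⟨ ·-[θ] σ θ (κ · M) ⟨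
  σ · nca M θ κ               ∎)
  where
  open ~-Reasoning
  L πL : List (ℕ × Ty)
  L = supp M
  πL = List.map (act π) L
  κ σ : Perm
  κ = swaps (freshPairs k L)
  σ = swaps (freshPairs k πL)

  σκ-agrees : ∀ {a C} → InSupp a C M → to π C a ≡ to (σ ∘ₚ κ) C a
  σκ-agrees {a} {C} ins with freshPairs-aligned π k L (∈-supp⁺ M ins)
  ... | m , a↔m , πa↔m =
    sym (trans (cong (to σ C) (swaps-left _ L-separated a↔m)) (swaps-right _ πL-separated πa↔m))
    where
    L-separated : Separated (freshPairs k L)
    L-separated = freshPairs-separated k L (supp-unique M) M<k
    πL-separated : Separated (freshPairs k πL)
    πL-separated = freshPairs-separated k πL (map⁺ (act-injective π) (supp-unique M)) πM<k

  σ-fixes : ∀ x B {b C} → InSupp b C (Subst.map θ x B) → to σ C b ≡ b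
  σ-fixes x B {b} {C} ins = swaps-fix (freshPairs k πL) b∉
    where
    b∉ : (b , C) ∉ swapped (freshPairs k πL)
    b∉ m with ∈-swapped-freshPairs⁻ k πL m
    ... | inj₂ k≤b = <-irrefl refl (<-≤-trans (θ<k (∈-rangeNominals⁺ θ (InSupp⇒Occurs ins))) k≤b)
    ... | inj₁ b∈πL with ∈-map⁻ (act π) b∈πL
    ...   | (a , D) , a∈L , refl = avoids a D (∈-supp⁻ M a∈L) (x , B , ins)

  θ~σθ : ∀ x B → Subst.map θ x B ~ σ · Subst.map θ x B
  θ~σθ x B = ~sym (·-fix-InSupp σ _ (σ-fixes x B))

nca-≈-choice : ∀ {A} (M : Term A) (θ : Subst) (π π' : Perm) → Avoids π M θ → Avoids π' M θ →
         nca M θ π ≈ nca M θ π'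
nca-≈-choice M θ π π' avoids avoids' =
  ≈-trans (nca-≈-fresh M θ π avoids k L<k πL<k θ<k)
          (≈-sym (nca-≈-fresh M θ π' avoids' k L<k π'L<k θ<k))
  where
  L πL π'L names : List (ℕ × Ty)
  L = supp M
  πL = List.map (act π) L
  π'L = List.map (act π') L
  names = L ++ πL ++ π'L ++ rangeNominals θ
  k : ℕ
  k = suc (max 0 (List.map proj₁ names))
  names<k : Below k names
  names<k = Below-suc-max names
  L<k : Below k L
  L<k m = names<k (∈-++⁺ˡ m)
  πL<k : Below k πL
  πL<k m = names<k (∈-++⁺ʳ L (∈-++⁺ˡ m))
  π'L<k : Below k π'L
  π'L<k m = names<k (∈-++⁺ʳ L (∈-++⁺ʳ πL (∈-++⁺ˡ m)))
  θ<k : Below k (rangeNominals θ)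
  θ<k m = names<k (∈-++⁺ʳ L (∈-++⁺ʳ πL (∈-++⁺ʳ π'L m)))

lemma1 : ∀ {A} (t t' : Term A) → t ≈ t' → (θ : Subst) →
         (π π' : Perm) → Avoids π t θ → Avoids π' t' θ →
         nca t θ π ≈ nca t' θ π'
lemma1 t t' (ρ , t~ρt') θ π π' avoids avoids' =
  ~-≈-trans (~-[θ] θ πt~πρt') (nca-≈-choice t' θ (π ∘ₚ ρ) π' avoids-πρ avoids')
  where
  πt~πρt' : π · t ~ (π ∘ₚ ρ) · t'
  πt~πρt' = transport (π · t ~_) (sym (∘ₚ-· π ρ t')) (~-perm π t~ρt')
  avoids-πρ : Avoids (π ∘ₚ ρ) t' θ
  avoids-πρ a C ins = avoids (to ρ C a) C (InSupp-· ρ t~ρt' ins)
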